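{- Let $\mathbf B$ be a finite MTL-chain and $a,b\in B^+$ with $b\le a$. Then in every $\mathbf B$-preference model $(W,P,e)$, for every $v\in W$ and all formulas $\varphi$: $$e\big(v,\Box^<_b\varphi\to\Box_a\Box^<_b\varphi\big)=1\quad\text{and}\quad e\big(v,\Box^<_b\varphi\to\Box^<_b\Box_a\varphi\big)=1.$$
   Context: A finite MTL-chain is a finite linearly ordered bounded integral commutative residuated lattice $\mathbf B=(B,\wedge,\vee,\odot,\to,0,1)$; $B^+=B\setminus\{0\}$. A $\mathbf B$-preference model is $(W,P,e)$ with $W\ne\emptyset$, $P:W\times W\to B$ reflexive ($P(u,u)=1$) and $\wedge$-transitive ($P(u,v)\wedge P(v,w)\le P(u,w)$), and $e$ a valuation of variables in $B$ at each world, extended by $e(v,\overline c)=c$, connectives computed in $\mathbf B$, $e(v,\Box_c\varphi)=\bigwedge\{e(w,\varphi):P(v,w)\ge c\}$ ($c\in B$), $e(v,\Box^<_c\varphi)=\bigwedge\{e(w,\varphi):P(v,w)\ge c,\ P(w,v)<c\}$ ($c\in B^+$). -}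

module Defs where

open import Data.Nat using (ℕ)
open import Data.Product using (Σ; _×_; _,_)
open import Data.Sum using (_⊎_)
open import Data.List using (List)
open import Data.List.Membership.Propositional using (_∈_)
open import Relation.Binary.PropositionalEquality using (_≡_)
open import Relation.Nullary using (¬_)
open import Function.Bundles using (_⇔_)

record FiniteMTLChain : Set₁ where
  infix  4 _≤_ _<_
  infixr 7 _⊙_
  infixr 6 _∧_ _∨_
  infixr 5 _⇒_
  field
    Carrier   : Set
    elements  : List Carrier
    complete  : ∀ x → x ∈ elements
    _≤_       : Carrier → Carrier → Set
    ≤-refl    : ∀ x → x ≤ x
    ≤-trans   : ∀ {x y z} → x ≤ y → y ≤ z → x ≤ z
    ≤-antisym : ∀ {x y} → x ≤ y → y ≤ x → x ≡ y
    ≤-total   : ∀ x y → (x ≤ y) ⊎ (y ≤ x)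
    _∧_       : Carrier → Carrier → Carrier
    _∨_       : Carrier → Carrier → Carrier
    ∧-lb₁     : ∀ x y → x ∧ y ≤ x
    ∧-lb₂     : ∀ x y → x ∧ y ≤ y
    ∧-glb     : ∀ {x y z} → z ≤ x → z ≤ y → z ≤ x ∧ y
    ∨-ub₁     : ∀ x y → x ≤ x ∨ y
    ∨-ub₂     : ∀ x y → y ≤ x ∨ y
    ∨-lub     : ∀ {x y z} → x ≤ z → y ≤ z → x ∨ y ≤ z
    0#        : Carrier
    1#        : Carrier
    0-bot     : ∀ x → 0# ≤ x
    1-top     : ∀ x → x ≤ 1#
    _⊙_       : Carrier → Carrier → Carrier
    ⊙-assoc   : ∀ x y z → (x ⊙ y) ⊙ z ≡ x ⊙ (y ⊙ z)
    ⊙-comm    : ∀ x y → x ⊙ y ≡ y ⊙ x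
    ⊙-identity : ∀ x → 1# ⊙ x ≡ x
    _⇒_       : Carrier → Carrier → Carrier
    residuation : ∀ x y z → (x ⊙ y ≤ z) ⇔ (x ≤ y ⇒ z)

  _<_ : Carrier → Carrier → Set
  x < y = (x ≤ y) × ¬ (x ≡ y)

module _ (B : FiniteMTLChain) where
  open FiniteMTLChain B

  -- Formulas: variables, truth constants c̄ (c ∈ B), MTL connectives,
  -- □_c (c ∈ B) and □^<_c (c ∈ B⁺, i.e. c ≠ 0).
  infixr 5 _⇒ᶠ_
  infixr 6 _∧ᶠ_ _∨ᶠ_
  infixr 7 _⊙ᶠ_
  data Fm : Set where
    var   : ℕ → Fm
    const : Carrier → Fm
    _∧ᶠ_ _∨ᶠ_ _⊙ᶠ_ _⇒ᶠ_ : Fm → Fm → Fm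
    □     : Carrier → Fm → Fm
    □<    : (c : Carrier) → ¬ (c ≡ 0#) → Fm → Fm

  record PrefModel : Set₁ where
    field
      W      : Set
      w₀     : W                          -- W ≠ ∅
      P      : W → W → Carrier
      P-refl : ∀ u → P u u ≡ 1#
      P-trans : ∀ u v w → P u v ∧ P v w ≤ P u w
      e      : W → ℕ → Carrier

  IsInf : {W : Set} → (W → Set) → (W → Carrier) → Carrier → Set
  IsInf {W} S f x = (∀ w → S w → x ≤ f w)
                  × (∀ z → (∀ w → S w → z ≤ f w) → z ≤ x)

  -- E : W → Fm → B is the (unique) extension of e to all formulas, i.e. it
  -- satisfies the Tarskian clauses.  (Infima over arbitrary W cannot be
  -- computed constructively, so the evaluation is characterised by its clauses.)
  record IsEvaluation (M : PrefModel) (E : PrefModel.W M → Fm → Carrier) : Set where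
    open PrefModel M
    field
      ev-var   : ∀ v p → E v (var p) ≡ e v p
      ev-const : ∀ v c → E v (const c) ≡ c
      ev-∧     : ∀ v φ ψ → E v (φ ∧ᶠ ψ) ≡ E v φ ∧ E v ψ
      ev-∨     : ∀ v φ ψ → E v (φ ∨ᶠ ψ) ≡ E v φ ∨ E v ψ
      ev-⊙     : ∀ v φ ψ → E v (φ ⊙ᶠ ψ) ≡ E v φ ⊙ E v ψ
      ev-⇒     : ∀ v φ ψ → E v (φ ⇒ᶠ ψ) ≡ E v φ ⇒ E v ψ
      ev-□     : ∀ v c φ →
                 IsInf (λ w → c ≤ P v w) (λ w → E w φ) (E v (□ c φ))
      ev-□<    : ∀ v c (c≢0 : ¬ (c ≡ 0#)) φ →
                 IsInf (λ w → (c ≤ P v w) × (P w v < c)) (λ w → E w φ)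
                       (E v (□< c c≢0 φ))

module Submission where

-- Both axioms are valid because of two frame conditions of the threshold
-- relations  v ≥c w :⇔ c ≤ P v w  and  v >c w :⇔ v ≥c w and not w ≥c v.
-- By ∧-transitivity of P (in a chain, c ≤ x and c ≤ y give c ≤ x ∧ y) every
-- ≥c is transitive, ≥a ⊆ ≥b when b ≤ a, and the strict part absorbs the
-- weak one on either side:  ≥b ∘ >b ⊆ >b  and  >b ∘ ≥b ⊆ >b.
-- Semantically, a box over a composite relation contained in the relation of
-- a single box is bounded below by that single box (lemma inf-of-infs).
-- With ≥a ∘ >b ⊆ >b this gives  □<b φ ≤ □a □<b φ, with >b ∘ ≥a ⊆ >b it
-- gives  □<b φ ≤ □<b □a φ, and an implication x ⇒ y between values with
-- x ≤ y evaluates to 1 in any integral residuated lattice.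

open import Defs
open import Data.Product using (_×_; _,_; proj₂)
open import Data.Sum using (inj₁; inj₂)
open import Data.Empty using (⊥-elim)
open import Relation.Binary.PropositionalEquality using (_≡_; sym; subst)
open import Relation.Nullary using (¬_)
open import Function.Bundles using (Equivalence)

module ChainFacts (B : FiniteMTLChain) where
  open FiniteMTLChain B

  ⇒-one : ∀ {x y} → x ≤ y → x ⇒ y ≡ 1#
  ⇒-one {x} {y} x≤y = ≤-antisym (1-top _)
    (Equivalence.to (residuation 1# x y)
      (subst (λ t → t ≤ y) (sym (⊙-identity x)) x≤y))

  ≰⇒> : ∀ {c x} → ¬ (c ≤ x) → x < c
  ≰⇒> {c} {x} c≰x with ≤-total x c
  ... | inj₁ x≤c = x≤c , λ x≡c → c≰x (subst (c ≤_) (sym x≡c) (≤-refl c))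
  ... | inj₂ c≤x = ⊥-elim (c≰x c≤x)

  <⇒≱ : ∀ {c x} → x < c → ¬ (c ≤ x)
  <⇒≱ (x≤c , x≢c) c≤x = x≢c (≤-antisym x≤c c≤x)

  ≤-meet-bound : ∀ {c x y z} → c ≤ x → c ≤ y → x ∧ y ≤ z → c ≤ z
  ≤-meet-bound c≤x c≤y x∧y≤z = ≤-trans (∧-glb c≤x c≤y) x∧y≤z

module Frame (B : FiniteMTLChain) (M : PrefModel B) where
  open FiniteMTLChain B
  open PrefModel M
  open ChainFacts B

  Above : Carrier → W → W → Set
  Above c v w = c ≤ P v w

  StrictlyAbove : Carrier → W → W → Set
  StrictlyAbove c v w = Above c v w × P w v < c

  Above-trans : ∀ {c u v w} → Above c u v → Above c v w → Above c u w
  Above-trans {u = u} {v} {w} uv vw = ≤-meet-bound uv vw (P-trans u v w)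

  Above-mono : ∀ {a b v w} → b ≤ a → Above a v w → Above b v w
  Above-mono b≤a avw = ≤-trans b≤a avw

  Above-Strict : ∀ {c v w u} →
                 Above c v w → StrictlyAbove c w u → StrictlyAbove c v u
  Above-Strict vw (wu , uw<c) =
    Above-trans vw wu , ≰⇒> λ uv → <⇒≱ uw<c (Above-trans uv vw)

  Strict-Above : ∀ {c v w u} →
                 StrictlyAbove c v w → Above c w u → StrictlyAbove c v u
  Strict-Above (vw , wv<c) wu =
    Above-trans vw wu , ≰⇒> λ uv → <⇒≱ wv<c (Above-trans wu uv)

module Infima (B : FiniteMTLChain) where
  open FiniteMTLChain B

  inf-of-infs : {W : Set} {S T : W → Set} {U : W → W → Set}
                {f g : W → Carrier} {x y : Carrier} →
                IsInf B S f x → IsInf B T g y →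
                (∀ w → T w → IsInf B (U w) f (g w)) →
                (∀ w u → T w → U w u → S u) →
                x ≤ y
  inf-of-infs (x-lower , _) (_ , y-greatest) g-inf composite⊆S =
    y-greatest _ λ w Tw →
      proj₂ (g-inf w Tw) _ λ u Uwu → x-lower u (composite⊆S w u Tw Uwu)

lemma3 : (B : FiniteMTLChain) →
    let open FiniteMTLChain B in
    (a b : Carrier) (a≢0 : ¬ (a ≡ 0#)) (b≢0 : ¬ (b ≡ 0#)) → b ≤ a →
    (M : PrefModel B) (E : PrefModel.W M → Fm B → Carrier) →
    IsEvaluation B M E →
    (v : PrefModel.W M) (φ : Fm B) →
    (E v (□< b b≢0 φ ⇒ᶠ □ a (□< b b≢0 φ)) ≡ 1#)
    × (E v (□< b b≢0 φ ⇒ᶠ □< b b≢0 (□ a φ)) ≡ 1#)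
lemma3 B a b a≢0 b≢0 b≤a M E ev v φ =
    valid (inf-of-infs (ev-□< v b b≢0 φ) (ev-□ v a _)
             (λ w _ → ev-□< w b b≢0 φ)
             (λ w u va≥w w>u → Above-Strict (Above-mono b≤a va≥w) w>u))
  , valid (inf-of-infs (ev-□< v b b≢0 φ) (ev-□< v b b≢0 _)
             (λ w _ → ev-□ w a φ)
             (λ w u v>w wa≥u → Strict-Above v>w (Above-mono b≤a wa≥u)))
  where
  open FiniteMTLChain B
  open IsEvaluation ev
  open ChainFacts B
  open Frame B M
  open Infima B

  valid : ∀ {ψ χ} → E v ψ ≤ E v χ → E v (ψ ⇒ᶠ χ) ≡ 1#
  valid {ψ} {χ} le = subst (_≡ 1#) (sym (ev-⇒ v ψ χ)) (⇒-one le)
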